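{- For every instance, if $\mathcal{S}$ is a schedule minimizing the average flow time $\frac1n\sum_{i=1}^n f_i(\mathcal{S})$, then $F(\mathcal{S})\le n\cdot F(\mathcal{OPT})$.
   Context: A single machine and $n$ jobs; job $J_i$ has integer release time $r_i\ge0$ and integer processing time $p_i\ge1$. Time is divided into unit slots $[t]=[t,t+1)$, $t\in\mathbb{N}$; a (preemptive) schedule assigns each slot to at most one job so that $J_i$ receives exactly $p_i$ slots, all with $t\ge r_i$. $c_i(\mathcal{S})$ is $1$ plus the last slot of $J_i$, $f_i(\mathcal{S})=c_i(\mathcal{S})-r_i$, $F(\mathcal{S})=\sum_i f_i(\mathcal{S})^2$, and $\mathcal{OPT}$ is a schedule minimizing $F$. -}

module Defs where

open import Data.Nat using (ℕ; zero; suc; _+_; _*_; _∸_; _≤_; _≥_)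
open import Data.Fin using (Fin)
import Data.Fin as Fin
open import Data.Maybe using (Maybe; just; nothing)
open import Data.Vec.Functional using (foldr)
open import Relation.Binary.PropositionalEquality using (_≡_)
open import Relation.Nullary using (yes; no)

record Instance (n : ℕ) : Set where
  field
    r   : Fin n → ℕ
    p   : Fin n → ℕ
    p≥1 : ∀ i → p i ≥ 1
open Instance public

-- A (preemptive) slot assignment: slot t = [t, t+1) is given to at most one
-- job (σ t = just i) or left idle (σ t = nothing).  Only finitely many slots
-- are used, witnessed by a horizon T after which everything is idle.
record Assignment (n : ℕ) : Set where
  field
    horizon : ℕ
    σ       : ℕ → Maybe (Fin n)
    idle    : ∀ t → horizon ≤ t → σ t ≡ nothing
open Assignment public

countBelow : ∀ {n} → (ℕ → Maybe (Fin n)) → Fin n → ℕ → ℕ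
countBelow σ i zero = 0
countBelow σ i (suc t) with σ t
... | nothing = countBelow σ i t
... | just j with j Fin.≟ i
...   | yes _ = suc (countBelow σ i t)
...   | no  _ = countBelow σ i t

lastPlusOne : ∀ {n} → (ℕ → Maybe (Fin n)) → Fin n → ℕ → ℕ
lastPlusOne σ i zero = 0
lastPlusOne σ i (suc t) with σ t
... | nothing = lastPlusOne σ i t
... | just j with j Fin.≟ i
...   | yes _ = suc t
...   | no  _ = lastPlusOne σ i t

slots : ∀ {n} → Assignment n → Fin n → ℕ
slots S i = countBelow (σ S) i (horizon S)

record IsSchedule {n : ℕ} (I : Instance n) (S : Assignment n) : Set where
  field
    exact   : ∀ i → slots S i ≡ p I i
    release : ∀ i t → σ S t ≡ just i → r I i ≤ t

completion : ∀ {n} → Assignment n → Fin n → ℕ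
completion S i = lastPlusOne (σ S) i (horizon S)

-- f_i(S) = c_i(S) - r_i   (c_i > r_i for any schedule, so ∸ is exact)
flow : ∀ {n} → Instance n → Assignment n → Fin n → ℕ
flow I S i = completion S i ∸ r I i

sumFin : ∀ {n} → (Fin n → ℕ) → ℕ
sumFin f = foldr _+_ 0 f

-- total flow time  Σ_i f_i(S)  (n times the average flow time)
totalFlow : ∀ {n} → Instance n → Assignment n → ℕ
totalFlow I S = sumFin (λ i → flow I S i)

F : ∀ {n} → Instance n → Assignment n → ℕ
F I S = sumFin (λ i → flow I S i * flow I S i)

{-# OPTIONS --safe #-}
-- Flow times are non-negative, so Σ f² ≤ (Σ f)²; by Cauchy–Schwarz,
-- (Σ f)² ≤ n Σ f².  Hence F(S) ≤ (Σ_i f_i(S))² ≤ (Σ_i f_i(OPT))² ≤ n F(OPT),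
-- the middle step because S minimises the total flow time.
module Submission where

open import Defs
open import Data.Nat using (ℕ; zero; suc; _+_; _*_; _≤_)
open import Data.Nat.Properties
open import Data.Nat.Tactic.RingSolver using (solve-∀)
open import Data.Fin using (Fin)
import Data.Fin as Fin
open import Data.Product using (_,_)
open import Data.Sum using (inj₁; inj₂)
open import Relation.Binary.PropositionalEquality using (_≡_; refl; cong; subst₂)

sumSq : ∀ {n} → (Fin n → ℕ) → ℕ
sumSq f = sumFin (λ i → f i * f i)

sumSq≤sum*sum : ∀ n (f : Fin n → ℕ) → sumSq f ≤ sumFin f * sumFin f
sumSq≤sum*sum zero    f = ≤-refl
sumSq≤sum*sum (suc n) f = begin
  x * x + sumSq g                                     ≤⟨ +-monoʳ-≤ (x * x) (sumSq≤sum*sum n g) ⟩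
  x * x + sumFin g * sumFin g                         ≤⟨ +-monoʳ-≤ (x * x) (m≤n+m _ (2 * (x * sumFin g))) ⟩
  x * x + (2 * (x * sumFin g) + sumFin g * sumFin g) ≡⟨ square x (sumFin g) ⟩
  (x + sumFin g) * (x + sumFin g)                     ∎
  where
  open ≤-Reasoning
  x : ℕ
  x = f Fin.zero
  g : Fin n → ℕ
  g i = f (Fin.suc i)
  square : ∀ x s → x * x + (2 * (x * s) + s * s) ≡ (x + s) * (x + s)
  square = solve-∀

2*m*[m+d]≤m*m+[m+d]*[m+d] : ∀ m d → 2 * (m * (m + d)) ≤ m * m + (m + d) * (m + d)
2*m*[m+d]≤m*m+[m+d]*[m+d] m d = begin
  2 * (m * (m + d))                    ≤⟨ m≤m+n _ (d * d) ⟩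
  2 * (m * (m + d)) + d * d            ≡⟨ expand m d ⟩
  m * m + (m + d) * (m + d)            ∎
  where
  open ≤-Reasoning
  expand : ∀ m d → 2 * (m * (m + d)) + d * d ≡ m * m + (m + d) * (m + d)
  expand = solve-∀

2*m*n≤m*m+n*n : ∀ m n → 2 * (m * n) ≤ m * m + n * n
2*m*n≤m*m+n*n m n with ≤-total m n
... | inj₁ m≤n with m≤n⇒∃[o]m+o≡n m≤n
...   | d , refl = 2*m*[m+d]≤m*m+[m+d]*[m+d] m d
2*m*n≤m*m+n*n m n | inj₂ n≤m with m≤n⇒∃[o]m+o≡n n≤m
...   | d , refl = subst₂ _≤_ (cong (2 *_) (*-comm n (n + d))) (+-comm (n * n) _)
                     (2*m*[m+d]≤m*m+[m+d]*[m+d] n d)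

2*a*sum≤n*a*a+sumSq : ∀ n (f : Fin n → ℕ) a → 2 * (a * sumFin f) ≤ n * (a * a) + sumSq f
2*a*sum≤n*a*a+sumSq zero    f a rewrite *-zeroʳ a = ≤-refl
2*a*sum≤n*a*a+sumSq (suc n) f a = begin
  2 * (a * (x + sumFin g))                      ≡⟨ distrib a x (sumFin g) ⟩
  2 * (a * x) + 2 * (a * sumFin g)              ≤⟨ +-mono-≤ (2*m*n≤m*m+n*n a x) (2*a*sum≤n*a*a+sumSq n g a) ⟩
  (a * a + x * x) + (n * (a * a) + sumSq g)     ≡⟨ regroup a x n (sumSq g) ⟩
  suc n * (a * a) + (x * x + sumSq g)           ∎
  where
  open ≤-Reasoning
  x : ℕ
  x = f Fin.zero
  g : Fin n → ℕ
  g i = f (Fin.suc i)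
  distrib : ∀ a x s → 2 * (a * (x + s)) ≡ 2 * (a * x) + 2 * (a * s)
  distrib = solve-∀
  regroup : ∀ a x n q → (a * a + x * x) + (n * (a * a) + q) ≡ (1 + n) * (a * a) + (x * x + q)
  regroup = solve-∀

sum*sum≤n*sumSq : ∀ n (f : Fin n → ℕ) → sumFin f * sumFin f ≤ n * sumSq f
sum*sum≤n*sumSq zero    f = ≤-refl
sum*sum≤n*sumSq (suc n) f = begin
  (x + sumFin g) * (x + sumFin g)                         ≡⟨ square x (sumFin g) ⟩
  x * x + 2 * (x * sumFin g) + sumFin g * sumFin g
    ≤⟨ +-mono-≤ (+-monoʳ-≤ (x * x) (2*a*sum≤n*a*a+sumSq n g x)) (sum*sum≤n*sumSq n g) ⟩
  x * x + (n * (x * x) + sumSq g) + n * sumSq g           ≡⟨ regroup x n (sumSq g) ⟩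
  suc n * (x * x + sumSq g)                               ∎
  where
  open ≤-Reasoning
  x : ℕ
  x = f Fin.zero
  g : Fin n → ℕ
  g i = f (Fin.suc i)
  square : ∀ x s → (x + s) * (x + s) ≡ x * x + 2 * (x * s) + s * s
  square = solve-∀
  regroup : ∀ x n q → x * x + (n * (x * x) + q) + n * q ≡ (1 + n) * (x * x + q)
  regroup = solve-∀

propositionC1 : ∀ (n : ℕ) (I : Instance n) (S OPT : Assignment n) →
    IsSchedule I S →
    (∀ S′ → IsSchedule I S′ → totalFlow I S ≤ totalFlow I S′) →
    IsSchedule I OPT →
    (∀ S′ → IsSchedule I S′ → F I OPT ≤ F I S′) →
    F I S ≤ n * F I OPT
propositionC1 n I S OPT _ S-minimises-flow OPT-schedule _ = begin
  F I S                                ≤⟨ sumSq≤sum*sum n (flow I S) ⟩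
  totalFlow I S * totalFlow I S        ≤⟨ *-mono-≤ S≤OPT S≤OPT ⟩
  totalFlow I OPT * totalFlow I OPT    ≤⟨ sum*sum≤n*sumSq n (flow I OPT) ⟩
  n * F I OPT                          ∎
  where
  open ≤-Reasoning
  S≤OPT : totalFlow I S ≤ totalFlow I OPT
  S≤OPT = S-minimises-flow OPT OPT-schedule
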